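{- Let $G$ be a $K_4$-free bridged graph and $z$ a vertex of $G$. Then each fiber $F(x)$, $x\in \mathrm{St}(z)$, is starshaped with respect to $x$; that is, $I(x,u)\subseteq F(x)$ for every $u\in F(x)$.
   Context: All graphs are finite, simple, undirected and connected; $d_G$ denotes the shortest-path distance of $G$. A graph $G$ is bridged if every isometric cycle of $G$ has length $3$; a cycle $C$ is isometric if $d_C=d_G$ on its vertices. $G$ is $K_4$-free if it has no four pairwise adjacent vertices. $I(a,b)=\{c: d_G(a,c)+d_G(c,b)=d_G(a,b)\}$. $N[z]$ is the closed neighborhood of $z$. $\Pi(u,A)=\{a\in A: d_G(u,a)=\min_{b\in A}d_G(u,b)\}$ is the metric projection. The star $\mathrm{St}(z)$ consists of $N[z]$ together with all vertices $u'\notin N[z]$ having two neighbors in $N[z]$ (these two are necessarily adjacent). For $x\in N[z]$, the fiber $F(x)$ is the set of vertices $u$ with $\Pi(u,N[z])=\{x\}$. For $x\in\mathrm{St}(z)$ with $d_G(x,z)=2$, $F(x)$ is the set of vertices $u$ satisfying three conditions: $\Pi(u,N[z])$ consists of two adjacent vertices $v,w$; $x$ is adjacent to both $v$ and $w$; and $d_G(u,x)=d_G(u,v)-1$. -}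

module Defs where

open import Data.Nat using (ℕ; zero; suc; _+_; _∸_; _≤_; _<_; _⊓_; ∣_-_∣)
open import Data.Fin using (Fin; toℕ)
open import Data.Bool using (Bool; true)
open import Data.Product using (Σ; ∃; _×_; _,_)
open import Data.Sum using (_⊎_)
open import Relation.Nullary using (¬_)
open import Relation.Binary.PropositionalEquality using (_≡_; _≢_)

record Graph (n : ℕ) : Set where
  field
    adj   : Fin n → Fin n → Bool
    sym   : ∀ a b → adj a b ≡ true → adj b a ≡ true
    irrfl : ∀ a → ¬ (adj a a ≡ true)

module _ {n : ℕ} (G : Graph n) where
  open Graph G

  Adj : Fin n → Fin n → Set
  Adj a b = adj a b ≡ true

  data Walk : Fin n → Fin n → ℕ → Set where
    stop : ∀ {a} → Walk a a 0
    step : ∀ {a b c k} → Adj a b → Walk b c k → Walk a c (suc k)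

  -- d is the shortest-path distance of G: for all a b there is a walk of
  -- length d a b and every walk from a to b has length ≥ d a b.
  -- (Existence of such a d for all pairs is exactly connectivity of G.)
  IsDistance : (Fin n → Fin n → ℕ) → Set
  IsDistance d = ∀ a b → Walk a b (d a b) × (∀ k → Walk a b k → d a b ≤ k)

  K4Free : Set
  K4Free = ¬ (Σ (Fin n) λ a → Σ (Fin n) λ b → Σ (Fin n) λ c → Σ (Fin n) λ e →
                Adj a b × Adj a c × Adj a e × Adj b c × Adj b e × Adj c e)

  cycDist : (m : ℕ) → Fin m → Fin m → ℕ
  cycDist m i j = ∣ toℕ i - toℕ j ∣ ⊓ (m ∸ ∣ toℕ i - toℕ j ∣)

  record Cycle (m : ℕ) : Set where
    field
      vtx      : Fin m → Fin n
      len≥3    : 3 ≤ m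
      distinct : ∀ i j → vtx i ≡ vtx j → i ≡ j
      edges    : ∀ i j → cycDist m i j ≡ 1 → Adj (vtx i) (vtx j)

  Isometric : (Fin n → Fin n → ℕ) → ∀ {m} → Cycle m → Set
  Isometric d {m} C = ∀ i j → d (Cycle.vtx C i) (Cycle.vtx C j) ≡ cycDist m i j

  Bridged : (Fin n → Fin n → ℕ) → Set
  Bridged d = ∀ m (C : Cycle m) → Isometric d C → m ≡ 3

  module _ (d : Fin n → Fin n → ℕ) where

    N[_] : Fin n → Fin n → Set
    N[ z ] x = (x ≡ z) ⊎ Adj z x

    InProj : Fin n → (Fin n → Set) → Fin n → Set
    InProj u A a = A a × (∀ b → A b → d u a ≤ d u b)

    InInterval : Fin n → Fin n → Fin n → Set
    InInterval a b c = d a c + d c b ≡ d a b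

    Star : Fin n → Fin n → Set
    Star z x = N[ z ] x ⊎
      (¬ N[ z ] x × Σ (Fin n) λ v → Σ (Fin n) λ w →
         v ≢ w × N[ z ] v × N[ z ] w × Adj x v × Adj x w)

    ProjSingle : Fin n → Fin n → Fin n → Set
    ProjSingle z u x = InProj u N[ z ] x × (∀ y → InProj u N[ z ] y → y ≡ x)

    ProjEdge : Fin n → Fin n → Fin n → Fin n → Set
    ProjEdge z u v w = Adj v w × InProj u N[ z ] v × InProj u N[ z ] w ×
                       (∀ y → InProj u N[ z ] y → (y ≡ v) ⊎ (y ≡ w))

    -- the fiber F(x) (for x ∈ St(z)), as a predicate on u
    Fiber : Fin n → Fin n → Fin n → Set
    Fiber z x u =
      (N[ z ] x × ProjSingle z u x) ⊎
      (d x z ≡ 2 × Σ (Fin n) λ v → Σ (Fin n) λ w →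
         ProjEdge z u v w × Adj x v × Adj x w × d u x + 1 ≡ d u v)

module Submission where

-- Fix u, a vertex c ∈ I(x,u) and a vertex set A (here A = N[z]).
-- Say that A lies at offset k beyond x as seen from u when
-- d(u,b) ≥ d(u,x) + k for every b ∈ A.  Since c lies on a geodesic from
-- u to x, this bound descends from u to c (offset-descends), and a point
-- of A that is a nearest point for c is then also one for u
-- (proj-ascends).  For x ∈ N[z] (offset 0) this shows Π(c,N[z]) = {x};
-- for d(x,z) = 2 (offset 1) the two projections v, w of u are at distance
-- at most d(c,x) + 1 from c because they are neighbours of x, hence at
-- distance exactly d(c,x) + 1, and Π(c,N[z]) = {v,w}.

open import Defs
open import Data.Nat using (ℕ; suc; _+_; _≤_)
open import Data.Nat.Properties
open import Data.Fin using (Fin)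
open import Data.Product using (_×_; _,_; proj₁; proj₂)
open import Data.Sum using (inj₁; inj₂)
open import Relation.Binary.PropositionalEquality

module Walks {n : ℕ} (G : Graph n) where
  open Graph G using () renaming (sym to adj-sym)

  _++ʷ_ : ∀ {a b c k l} → Walk G a b k → Walk G b c l → Walk G a c (k + l)
  stop       ++ʷ q = q
  (step p w) ++ʷ q = step p (w ++ʷ q)

  reverse-onto : ∀ {a b c k m} → Walk G a b k → Walk G a c m → Walk G b c (k + m)
  reverse-onto stop acc = acc
  reverse-onto {k = suc k} {m = m} (step p w) acc =
    subst (Walk G _ _) (+-suc k m) (reverse-onto w (step (adj-sym _ _ p) acc))

  reverseʷ : ∀ {a b k} → Walk G a b k → Walk G b a k
  reverseʷ {k = k} w = subst (Walk G _ _) (+-identityʳ k) (reverse-onto w stop)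

module Metric {n : ℕ} (G : Graph n) (d : Fin n → Fin n → ℕ) (D : IsDistance G d) where
  open Walks G

  shortest : ∀ {a b k} → Walk G a b k → d a b ≤ k
  shortest w = proj₂ (D _ _) _ w

  triangle : ∀ a b c → d a c ≤ d a b + d b c
  triangle a b c = shortest (proj₁ (D a b) ++ʷ proj₁ (D b c))

  d-sym : ∀ a b → d a b ≡ d b a
  d-sym a b = ≤-antisym (shortest (reverseʷ (proj₁ (D b a))))
                        (shortest (reverseʷ (proj₁ (D a b))))

  adjacent≤1 : ∀ {a b} → Adj G a b → d a b ≤ 1
  adjacent≤1 p = shortest (step p stop)

  neighbour-bound : ∀ c {x a} → Adj G x a → d c a ≤ d c x + 1
  neighbour-bound c {x} {a} p =
    ≤-trans (triangle c x a) (+-monoʳ-≤ (d c x) (adjacent≤1 p))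

  interval-from-end : ∀ {x u c} → InInterval G d x u c → d u c + d c x ≡ d u x
  interval-from-end {x} {u} {c} I = begin
    d u c + d c x ≡⟨ +-comm (d u c) (d c x) ⟩
    d c x + d u c ≡⟨ cong₂ _+_ (d-sym c x) (d-sym u c) ⟩
    d x c + d c u ≡⟨ I ⟩
    d x u         ≡⟨ d-sym x u ⟩
    d u x         ∎
    where open ≡-Reasoning

  Beyond : Fin n → (Fin n → Set) → Fin n → ℕ → Set
  Beyond u A x k = ∀ b → A b → d u x + k ≤ d u b

  module _ {u c x : Fin n} (geo : d u c + d c x ≡ d u x) where

    offset-descends : ∀ {A k} → Beyond u A x k → Beyond c A x k
    offset-descends {A} {k} bound b Ab = +-cancelˡ-≤ (d u c) _ _ (begin
      d u c + (d c x + k) ≡⟨ +-assoc (d u c) (d c x) k ⟨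
      d u c + d c x + k   ≡⟨ cong (_+ k) geo ⟩
      d u x + k           ≤⟨ bound b Ab ⟩
      d u b               ≤⟨ triangle u c b ⟩
      d u c + d c b       ∎)
      where open ≤-Reasoning

    closeness-ascends : ∀ {y k} → d c y ≤ d c x + k → d u y ≤ d u x + k
    closeness-ascends {y} {k} cy = begin
      d u y               ≤⟨ triangle u c y ⟩
      d u c + d c y       ≤⟨ +-monoʳ-≤ (d u c) cy ⟩
      d u c + (d c x + k) ≡⟨ +-assoc (d u c) (d c x) k ⟨
      d u c + d c x + k   ≡⟨ cong (_+ k) geo ⟩
      d u x + k           ∎
      where open ≤-Reasoning

    proj-ascends : ∀ {A k a y} → Beyond u A x k → A a → d c a ≤ d c x + k →
                   InProj G d c A y → InProj G d u A y
    proj-ascends bound Aa ca (Ay , nearest) =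
      Ay , λ b Ab → ≤-trans (closeness-ascends (≤-trans (nearest _ Aa) ca)) (bound b Ab)

  proj-of-beyond : ∀ {u A x k a} → Beyond u A x k → A a → d u a ≤ d u x + k →
                   InProj G d u A a
  proj-of-beyond bound Aa ua = Aa , λ b Ab → ≤-trans ua (bound b Ab)

  module _ (z : Fin n) where
    private
      N : Fin n → Set
      N = N[_] G d z

    vertex-fiber-starshaped : ∀ {x u c} → N x → ProjSingle G d z u x →
                              d u c + d c x ≡ d u x → ProjSingle G d z c x
    vertex-fiber-starshaped {x} {u} {c} Nx ((_ , nearest) , unique) geo =
      proj-of-beyond bound-c Nx cx≤cx+0 ,
      λ y py → unique y (proj-ascends geo bound-u Nx cx≤cx+0 py)
      where
        cx≤cx+0 : d c x ≤ d c x + 0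
        cx≤cx+0 = ≤-reflexive (sym (+-identityʳ (d c x)))
        bound-u : Beyond u N x 0
        bound-u b Nb = ≤-trans (≤-reflexive (+-identityʳ (d u x))) (nearest b Nb)
        bound-c : Beyond c N x 0
        bound-c = offset-descends geo bound-u

    edge-fiber-starshaped : ∀ {x u c v w} → ProjEdge G d z u v w →
                            Adj G x v → Adj G x w → d u x + 1 ≡ d u v →
                            d u c + d c x ≡ d u x →
                            ProjEdge G d z c v w × d c x + 1 ≡ d c v
    edge-fiber-starshaped {x} {u} {c} {v} {w} (vw , (Nv , nearest) , (Nw , _) , unique) xv xw uv geo =
      (vw , proj-of-beyond bound-c Nv (neighbour-bound c xv)
          , proj-of-beyond bound-c Nw (neighbour-bound c xw)
          , λ y py → unique y (proj-ascends geo bound-u Nv (neighbour-bound c xv) py)) ,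
      ≤-antisym (bound-c v Nv) (neighbour-bound c xv)
      where
        bound-u : Beyond u N x 1
        bound-u b Nb = ≤-trans (≤-reflexive uv) (nearest b Nb)
        bound-c : Beyond c N x 1
        bound-c = offset-descends geo bound-u

lemma10 : ∀ {n} (G : Graph n) (d : Fin n → Fin n → ℕ) →
    IsDistance G d → K4Free G → Bridged G d →
    ∀ z x → Star G d z x →
    ∀ u → Fiber G d z x u →
    ∀ c → InInterval G d x u c → Fiber G d z x c
lemma10 G d D _ _ z x _ u (inj₁ (Nx , proj)) c I =
  inj₁ (Nx , vertex-fiber-starshaped z Nx proj (interval-from-end I))
  where open Metric G d D
lemma10 G d D _ _ z x _ u (inj₂ (dxz , v , w , proj , xv , xw , uv)) c I =
  let (proj′ , cv) = edge-fiber-starshaped z proj xv xw uv (interval-from-end I)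
  in inj₂ (dxz , v , w , proj′ , xv , xw , cv)
  where open Metric G d D
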